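{- Let $S_0,\ldots,S_i$ be a saturation such that the step producing $S_i$ applies (i.e., adds the conclusion of) a PRC inference of the form $$\frac{(l\approx r)\circ R_1 \qquad C[l']\circ R_2}{C[r]\sigma}$$ where $\sigma=\mathrm{mgu}(l,l')$. Let $$R\;=\;\exists\bar y.\,\big(l=l'\land l\succ r\land C[l']\succ l\big),$$ where $\bar y$ consists of all free variables occurring in $l$ and $r$ but not in $C[l']$. Then $R$ is admissible for $S_i$ and $C[l']$, i.e., for every substitution $\theta$ grounding for $C[l']$, if $\theta\models R$ then $C[l']\theta$ is redundant with respect to $S_i^*$.
   Context: Work in first-order logic with equality $\approx$ over a finite signature $\Sigma$ with at least one constant. Literals are unordered $s\approx t$ or $s\not\approx t$ ($s\doteq t$ for either); clauses are finite multisets of literals; $C[l']$ denotes a clause with a distinguished occurrence of a term $l'$ and $C[r]$ the result of replacing it by $r$. Fix a simplification order $\succ$ on terms (well-founded, closed under substitutions and contexts, subterm property, total on ground terms), extended to literals ($s\approx t\mapsto\{s,t\}$, $s\not\approx t\mapsto\{s,s,t,t\}$, multiset extension) and clauses (multiset extension). A ground clause $D$ is redundant w.r.t. a set $S$ of ground clauses if there are $C_1,\ldots,C_n\in S$ with $C_1,\ldots,C_n\models D$ and $D\succ C_i$ for all $i$. Redundancy formulas are first-order formulas over the structure $T_{\mathcal R}(\Sigma)$ whose universe is the set of ground terms (each denoting itself, $=$ syntactic identity) with finitely many fixed-interpretation predicates including $\succ$. Abbreviations: $s\succeq t$ is $s\succ t\lor s=t$; for $L=s\doteq t$, $L\succ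 l$ is $s\succ l\lor t\succ l$, $L\succeq l$ is $s\succeq l\lor t\succeq l$; for a clause $C=L_1\lor\cdots\lor L_n$, $C\succ l$ is $\bigvee_iL_i\succ l$ and $C\succeq l$ is $\bigvee_iL_i\succeq l$. A partial clause $C\circ R$ is a clause with a redundancy formula whose free variables occur in $C$. $\sigma\models R$ means every ground instance of $R\sigma$ holds in $T_{\mathcal R}(\Sigma)$; $\sigma\not\models R$ is its negation. The calculus PRC (variable-disjoint premises; displayed literals selected by a selection function satisfying the standard conditions): (Sup) from $(l\approx r\lor C_1)\circ R_1$, $(s[l']\doteq t\lor C_2)\circ R_2$ infer $(s[r]\doteq t\lor C_1\lor C_2)\sigma$ with $\sigma=\mathrm{mgu}(l,l')$, $l'$ not a variable, $\sigma\not\models r\succeq l$, $\sigma\not\models t\succeq s[l']$, $\sigma\not\models C_1\succeq l$, $\sigma\not\models C_2\succeq s[l']$ if $s[l']\doteq t$ is positive, $\sigma\not\models R_1$, $\sigma\not\models R_2$. (EqRes) from $(s\not\approx t\lor C)\circ R$ infer $C\sigma$ with $\sigma=\mathrm{mgu}(s,t)$, $\sigma\not\models R$. (EqFac) from $(s\approx t\lor s'\approx t'\lor C)\circ R$ infer $(s\approx t\lor t\not\approx t'\lor C)\sigma$ with $\sigma=\mathrm{mgu}(s,s')$, $\sigma\not\models t\succeq s$, $\sigma\not\models t'\succ t$, $\sigma\not\models C\succ s$, $\sigma\not\models R$. For a set $S$ of partial clauses, $S^*$ is the set of ground instances of clauses $C$ with $(C\circ R)\in S$ for some $R$. A saturation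 is a sequence $S_0,S_1,\ldots$ of sets of partial clauses, each member of $S_0$ of the form $C\circ\bot$, such that for each $k$ either $S_{k+1}$ is $S_k$ plus $D\circ\bot$ for the conclusion $D$ of a PRC inference with premises in $S_k$ (an inference step, said to be applied at step $S_{k+1}$), or $S_{k+1}$ arises from $S_k$ by replacing some $C\circ R_1$ by $C\circ(R_1\lor R_2)$ where for every $\theta$ grounding for $C$, $\theta\models R_2$ implies $C\theta$ is redundant w.r.t. $S_k^*$. A redundancy formula $R$ is admissible for a set $S$ of partial clauses and a clause $C$ if for every substitution $\sigma$ grounding for $C$, $\sigma\models R$ implies $C\sigma$ is redundant w.r.t. $S^*$. -}

module Defs where

open import Data.Nat using (ℕ; zero; suc; _<_; _≡ᵇ_)
open import Data.Bool using (Bool; true; false; if_then_else_)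
open import Data.Fin using (Fin)
open import Data.Vec using (Vec; []; _∷_; lookup; _[_]≔_)
import Data.Vec as Vec
open import Data.List using (List; []; _∷_; _++_; filter; foldr)
open import Data.List.Membership.Propositional using (_∈_; _∉_)
open import Data.List.Relation.Unary.All using (All)
open import Data.List.Relation.Unary.Any using (Any)
open import Data.List.Relation.Binary.Permutation.Homogeneous using (Permutation)
open import Data.Product using (Σ; _×_; _,_; ∃)
open import Data.Sum using (_⊎_)
open import Data.Empty using (⊥)
open import Data.Unit using (⊤)
open import Function using (_∘_; flip)
open import Function.Definitions using (Injective)
open import Relation.Nullary using (¬_)
open import Relation.Nullary.Decidable using (¬?)
open import Relation.Binary.PropositionalEquality using (_≡_; _≢_)
open import Induction.WellFounded using (WellFounded)
open import Data.List.Membership.DecPropositional Data.Nat._≟_ using (_∈?_)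

record Sig : Set₁ where
  field
    Fun      : Set
    arity    : Fun → ℕ
    funs     : List Fun                -- finiteness: an enumeration
    funs-all : ∀ f → f ∈ funs
    const    : Fun
    const-ar : arity const ≡ 0

module Terms (Σᶠ : Sig) where
  open Sig Σᶠ

  Var : Set
  Var = ℕ

  data Term : Set where
    var : Var → Term
    app : (f : Fun) → Vec Term (arity f) → Term

  Subst : Set
  Subst = Var → Term

  mutual
    _⟨_⟩ : Term → Subst → Term
    var x    ⟨ σ ⟩ = σ x
    app f ts ⟨ σ ⟩ = app f (ts ⟨ σ ⟩*)

    _⟨_⟩* : ∀ {n} → Vec Term n → Subst → Vec Term n
    []       ⟨ σ ⟩* = []
    (t ∷ ts) ⟨ σ ⟩* = (t ⟨ σ ⟩) ∷ (ts ⟨ σ ⟩*)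

  mutual
    vars : Term → List Var
    vars (var x)    = x ∷ []
    vars (app f ts) = vars* ts

    vars* : ∀ {n} → Vec Term n → List Var
    vars* []       = []
    vars* (t ∷ ts) = vars t ++ vars* ts

  IsGround : Term → Set
  IsGround t = ∀ x → x ∉ vars t

  -- one-hole contexts: s[l'] is  plug c l'
  data Ctx : Set where
    ∙   : Ctx
    app : (f : Fun) → Fin (arity f) → Vec Term (arity f) → Ctx → Ctx

  plug : Ctx → Term → Term
  plug ∙              t = t
  plug (app f i ts c) t = app f (ts [ i ]≔ plug c t)

  -- literals s ≐ t (pol = true: s ≈ t, pol = false: s ≉ t); unordered
  -- via the equivalence _≈L_ below
  record Lit : Set where
    constructor mkLit
    field
      pol : Bool
      lhs : Term
      rhs : Term
  open Lit public

  pos neg : Term → Term → Lit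
  pos s t = mkLit true s t
  neg s t = mkLit false s t

  _≈L_ : Lit → Lit → Set
  L ≈L M = pol L ≡ pol M ×
           ((lhs L ≡ lhs M × rhs L ≡ rhs M) ⊎ (lhs L ≡ rhs M × rhs L ≡ lhs M))

  -- clauses: finite multisets of literals, represented by lists;
  -- two lists denote the same clause iff _≅_ (permutation modulo _≈L_)
  Clause : Set
  Clause = List Lit

  _≅_ : Clause → Clause → Set
  C ≅ D = Permutation _≈L_ C D

  varsL : Lit → List Var
  varsL L = vars (lhs L) ++ vars (rhs L)

  varsC : Clause → List Var
  varsC []      = []
  varsC (L ∷ C) = varsL L ++ varsC C

  _⟨_⟩L : Lit → Subst → Lit
  mkLit p s t ⟨ σ ⟩L = mkLit p (s ⟨ σ ⟩) (t ⟨ σ ⟩)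

  _⟨_⟩C : Clause → Subst → Clause
  []      ⟨ σ ⟩C = []
  (L ∷ C) ⟨ σ ⟩C = (L ⟨ σ ⟩L) ∷ (C ⟨ σ ⟩C)

  Grounding : Subst → Clause → Set
  Grounding θ C = ∀ x → x ∈ varsC C → IsGround (θ x)

  IsMGU : Subst → Term → Term → Set
  IsMGU σ s t = (s ⟨ σ ⟩ ≡ t ⟨ σ ⟩) ×
                (∀ τ → s ⟨ τ ⟩ ≡ t ⟨ τ ⟩ → Σ Subst λ δ → ∀ x → τ x ≡ (σ x) ⟨ δ ⟩)

  MulExt : {A : Set} → (A → A → Set) → (A → A → Set) → List A → List A → Set
  MulExt {A} _≈_ _>_ M N =
    Σ (List A) λ X → Σ (List A) λ Y → Σ (List A) λ Z →
      Permutation _≈_ M (Z ++ X) × Permutation _≈_ N (Z ++ Y) ×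
      X ≢ [] × All (λ y → Any (λ x → x > y) X) Y

  record Structure : Set₁ where
    field
      Carrier : Set
      interp  : (f : Fun) → Vec Carrier (arity f) → Carrier

  module _ (M : Structure) (a : Var → Structure.Carrier M) where
    open Structure M
    mutual
      eval : Term → Carrier
      eval (var x)    = a x
      eval (app f ts) = interp f (eval* ts)

      eval* : ∀ {n} → Vec Term n → Vec Carrier n
      eval* []       = []
      eval* (t ∷ ts) = eval t ∷ eval* ts

    LitTrue : Lit → Set
    LitTrue (mkLit true  s t) = eval s ≡ eval t
    LitTrue (mkLit false s t) = ¬ (eval s ≡ eval t)

    ClauseTrue : Clause → Set
    ClauseTrue C = Any LitTrue C

  _⊨_ : List Clause → Clause → Set₁
  Cs ⊨ D = ∀ (M : Structure) (a : Var → Structure.Carrier M) →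
           All (ClauseTrue M a) Cs → ClauseTrue M a D

record SimpOrd (Σᶠ : Sig) : Set₁ where
  open Terms Σᶠ
  field
    _≻_       : Term → Term → Set
    irrefl    : ∀ {s} → ¬ (s ≻ s)
    trans     : ∀ {s t u} → s ≻ t → t ≻ u → s ≻ u
    wf        : WellFounded (flip _≻_)
    stable    : ∀ {s t} (σ : Subst) → s ≻ t → (s ⟨ σ ⟩) ≻ (t ⟨ σ ⟩)
    monotone  : ∀ {s t} (c : Ctx) → s ≻ t → plug c s ≻ plug c t
    subterm   : ∀ (c : Ctx) t → c ≢ ∙ → plug c t ≻ t
    total-gnd : ∀ {s t} → IsGround s → IsGround t → s ≡ t ⊎ (s ≻ t ⊎ t ≻ s)

-- finitely many extra predicates with fixed interpretation on ground terms
record PredSig (Σᶠ : Sig) : Set₁ where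
  open Terms Σᶠ
  field
    Pred      : Set
    parity    : Pred → ℕ
    preds     : List Pred
    preds-all : ∀ p → p ∈ preds
    pinterp   : (p : Pred) → Vec Term (parity p) → Set

record Selection (Σᶠ : Sig) : Set₁ where
  open Terms Σᶠ
  field
    Sel     : Clause → Lit → Set
    Sel-mem : ∀ {C L} → Sel C L → Any (L ≈L_) C

module PRC (Σᶠ : Sig) (Π : PredSig Σᶠ) (O : SimpOrd Σᶠ) (SF : Selection Σᶠ) where
  open Sig Σᶠ
  open Terms Σᶠ
  open PredSig Π
  open SimpOrd O
  open Selection SF

  litMS : Lit → List Term
  litMS (mkLit true  s t) = s ∷ t ∷ []
  litMS (mkLit false s t) = s ∷ s ∷ t ∷ t ∷ []

  _≻L_ : Lit → Lit → Set
  L ≻L M = MulExt _≡_ _≻_ (litMS L) (litMS M)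

  _≻C_ : Clause → Clause → Set
  C ≻C D = MulExt _≈L_ _≻L_ C D

  Redundant : Clause → (Clause → Set) → Set₁
  Redundant D T = Σ (List Clause) λ Cs → All T Cs × (Cs ⊨ D) × All (D ≻C_) Cs

  -- redundancy formulas over T_R(Σ): universe = ground terms
  data Formula : Set where
    ⊥f ⊤f     : Formula
    _=f_      : Term → Term → Formula
    _≻f_      : Term → Term → Formula
    pred      : (p : Pred) → Vec Term (parity p) → Formula
    ¬f_       : Formula → Formula
    _∧f_ _∨f_ : Formula → Formula → Formula
    ∃f ∀f     : Var → Formula → Formula

  fv : Formula → List Var
  fv ⊥f        = []
  fv ⊤f        = []
  fv (s =f t)  = vars s ++ vars t
  fv (s ≻f t)  = vars s ++ vars t
  fv (pred p ts) = vars* ts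
  fv (¬f φ)    = fv φ
  fv (φ ∧f ψ)  = fv φ ++ fv ψ
  fv (φ ∨f ψ)  = fv φ ++ fv ψ
  fv (∃f x φ)  = filter (λ y → ¬? (y Data.Nat.≟ x)) (fv φ)
  fv (∀f x φ)  = filter (λ y → ¬? (y Data.Nat.≟ x)) (fv φ)

  _[_↦_] : Subst → Var → Term → Subst
  (ρ [ x ↦ g ]) y = if y ≡ᵇ x then g else ρ y

  -- truth in T_R(Σ) under a valuation ρ of variables by ground terms
  ⟦_⟧ : Formula → Subst → Set
  ⟦ ⊥f ⟧ ρ        = ⊥
  ⟦ ⊤f ⟧ ρ        = ⊤
  ⟦ s =f t ⟧ ρ    = (s ⟨ ρ ⟩) ≡ (t ⟨ ρ ⟩)
  ⟦ s ≻f t ⟧ ρ    = (s ⟨ ρ ⟩) ≻ (t ⟨ ρ ⟩)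
  ⟦ pred p ts ⟧ ρ = pinterp p (ts ⟨ ρ ⟩*)
  ⟦ ¬f φ ⟧ ρ      = ¬ ⟦ φ ⟧ ρ
  ⟦ φ ∧f ψ ⟧ ρ    = ⟦ φ ⟧ ρ × ⟦ ψ ⟧ ρ
  ⟦ φ ∨f ψ ⟧ ρ    = ⟦ φ ⟧ ρ ⊎ ⟦ ψ ⟧ ρ
  ⟦ ∃f x φ ⟧ ρ    = Σ Term λ g → IsGround g × ⟦ φ ⟧ (ρ [ x ↦ g ])
  ⟦ ∀f x φ ⟧ ρ    = ∀ g → IsGround g → ⟦ φ ⟧ (ρ [ x ↦ g ])

  _⊨F_ : Subst → Formula → Set
  σ ⊨F R = ∀ (ρ : Subst) → (∀ x → IsGround (ρ x)) → ⟦ R ⟧ (λ x → σ x ⟨ ρ ⟩)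

  _⊭F_ : Subst → Formula → Set
  σ ⊭F R = ¬ (σ ⊨F R)

  _⪰f_ : Term → Term → Formula
  s ⪰f t = (s ≻f t) ∨f (s =f t)

  _L≻f_ _L⪰f_ : Lit → Term → Formula
  L L≻f l = (lhs L ≻f l) ∨f (rhs L ≻f l)
  L L⪰f l = (lhs L ⪰f l) ∨f (rhs L ⪰f l)

  _C≻f_ _C⪰f_ : Clause → Term → Formula
  C C≻f l = foldr (λ L φ → (L L≻f l) ∨f φ) ⊥f C
  C C⪰f l = foldr (λ L φ → (L L⪰f l) ∨f φ) ⊥f C

  ∃*f : List Var → Formula → Formula
  ∃*f []       φ = φ
  ∃*f (y ∷ ys) φ = ∃f y (∃*f ys φ)

  PClause : Set
  PClause = Clause × Formula

  PSet : Set₁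
  PSet = PClause → Set

  Star : PSet → Clause → Set
  Star S D = Σ Clause λ C → Σ Formula λ R → S (C , R) ×
             Σ Subst λ θ → Grounding θ C × D ≡ C ⟨ θ ⟩C

  Admissible : PSet → Clause → Formula → Set₁
  Admissible S C R = ∀ (θ : Subst) → Grounding θ C → θ ⊨F R → Redundant (C ⟨ θ ⟩C) (Star S)

  -- a premise: a variable-renamed copy of a member C₀ ∘ R₀ of S
  -- (the renamed formula R₀ρ satisfies  σ ⊨ R₀ρ  iff  (σ ∘ ρ) ⊨ R₀)
  record Premise (S : PSet) : Set where
    field
      cl₀    : Clause
      fm₀    : Formula
      member : S (cl₀ , fm₀)
      ren    : Var → Var
      ren-inj : Injective _≡_ _≡_ ren
    clause : Clause
    clause = cl₀ ⟨ var ∘ ren ⟩C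
    notR : Subst → Set
    notR σ = (σ ∘ ren) ⊭F fm₀

  Disjoint : Clause → Clause → Set
  Disjoint C D = ∀ x → x ∈ varsC C → x ∉ varsC D

  -- Superposition:  (l ≈ r ∨ C₁)∘R₁ , (s[l'] ≐ t ∨ C₂)∘R₂ ⊢ (s[r] ≐ t ∨ C₁ ∨ C₂)σ
  record Sup (S : PSet) : Set where
    field
      p₁ p₂    : Premise S
      disjoint : Disjoint (Premise.clause p₁) (Premise.clause p₂)
      l r      : Term
      C₁       : Clause
      shape₁   : Premise.clause p₁ ≅ (pos l r ∷ C₁)
      sel₁     : Sel (Premise.clause p₁) (pos l r)
      pl       : Bool
      c        : Ctx
      l' t     : Term
      C₂       : Clause
      shape₂   : Premise.clause p₂ ≅ (mkLit pl (plug c l') t ∷ C₂)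
      sel₂     : Sel (Premise.clause p₂) (mkLit pl (plug c l') t)
      l'-nonvar : ∀ x → l' ≢ var x
      σ        : Subst
      mgu      : IsMGU σ l l'
      ord₁     : σ ⊭F (r ⪰f l)
      ord₂     : σ ⊭F (t ⪰f plug c l')
      ord₃     : σ ⊭F (C₁ C⪰f l)
      ord₄     : pl ≡ true → σ ⊭F (C₂ C⪰f plug c l')
      cR₁      : Premise.notR p₁ σ
      cR₂      : Premise.notR p₂ σ
    premise₂ : Clause
    premise₂ = mkLit pl (plug c l') t ∷ C₂
    conclusion : Clause
    conclusion = (mkLit pl (plug c r) t ∷ (C₁ ++ C₂)) ⟨ σ ⟩C

  record EqRes (S : PSet) : Set where
    field
      p     : Premise S
      s t   : Term
      C     : Clause
      shape : Premise.clause p ≅ (neg s t ∷ C)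
      sel   : Sel (Premise.clause p) (neg s t)
      σ     : Subst
      mgu   : IsMGU σ s t
      cR    : Premise.notR p σ
    conclusion : Clause
    conclusion = C ⟨ σ ⟩C

  record EqFac (S : PSet) : Set where
    field
      p        : Premise S
      s t s' t' : Term
      C        : Clause
      shape    : Premise.clause p ≅ (pos s t ∷ pos s' t' ∷ C)
      sel₁     : Sel (Premise.clause p) (pos s t)
      sel₂     : Sel (Premise.clause p) (pos s' t')
      σ        : Subst
      mgu      : IsMGU σ s s'
      ord₁     : σ ⊭F (t ⪰f s)
      ord₂     : σ ⊭F (t' ≻f t)
      ord₃     : σ ⊭F (C C≻f s)
      cR       : Premise.notR p σ
    conclusion : Clause
    conclusion = (pos s t ∷ neg t t' ∷ C) ⟨ σ ⟩C

  Infers : PSet → Clause → Set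
  Infers S D = (Σ (Sup S) λ i → Sup.conclusion i ≡ D)
             ⊎ (Σ (EqRes S) λ i → EqRes.conclusion i ≡ D)
             ⊎ (Σ (EqFac S) λ i → EqFac.conclusion i ≡ D)

  _≐S_ : PSet → PSet → Set
  A ≐S B = ∀ x → (A x → B x) × (B x → A x)

  InferenceStep : PSet → PSet → Set
  InferenceStep S S' = Σ Clause λ D → Infers S D × (S' ≐S (λ x → S x ⊎ x ≡ (D , ⊥f)))

  RedundancyStep : PSet → PSet → Set₁
  RedundancyStep S S' =
    Σ Clause λ C → Σ Formula λ R₁ → Σ Formula λ R₂ →
      S (C , R₁) ×
      (∀ x → x ∈ fv R₂ → x ∈ varsC C) ×          -- C ∘ R₂ is a partial clause
      (∀ θ → Grounding θ C → θ ⊨F R₂ → Redundant (C ⟨ θ ⟩C) (Star S)) ×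
      (S' ≐S (λ x → (S x × x ≢ (C , R₁)) ⊎ x ≡ (C , R₁ ∨f R₂)))

  Step : PSet → PSet → Set₁
  Step S S' = InferenceStep S S' ⊎ RedundancyStep S S'

  Saturation : (ℕ → PSet) → ℕ → Set₁
  Saturation S n = (∀ x → S 0 x → Σ Clause λ C → x ≡ (C , ⊥f))
                 × (∀ k → k < n → Step (S k) (S (suc k)))

  lemmaR : Term → Term → Term → Clause → Formula
  lemmaR l r l' C =
    ∃*f (filter (λ y → ¬? (y ∈? varsC C)) (vars l ++ vars r))
        ((l =f l') ∧f ((l ≻f r) ∧f (C C≻f l)))

-- Suppose θ ⊨ R. Grounding the existential witnesses gives a ground θ′ that agrees with
-- θ on C[l′] and satisfies lθ′ = l′θ′ ≻ rθ′ and C[l′]θ′ ≻ lθ′. Since σ is most general,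
-- θ′ factors through σ, so C[r]θ′ is a ground instance of the conclusion, which lies in
-- Sᵢ. Now C[l′]θ′ follows from lθ′ ≈ rθ′ (an instance of the first premise) and C[r]θ′,
-- and both are smaller: the first because C[l′]θ′ has a side above lθ′ ≻ rθ′, the
-- second because rewriting with lθ′ ≻ rθ′ decreases the rewritten literal.
module Submission where

open import Defs
import Data.Bool as Bool
open import Data.Bool using (true; false)
open import Data.Empty using (⊥-elim)
open import Data.Fin using () renaming (zero to fzero; suc to fsuc)
open import Data.List using (List; []; _∷_; _++_; filter)
open import Data.List.Membership.Propositional using (_∈_; _∉_)
open import Data.List.Membership.Propositional.Properties using (∈-++⁺ˡ; ∈-++⁺ʳ; ∈-++⁻; ∈-filter⁻)
open import Data.List.Relation.Binary.Permutation.Homogeneous using (refl; prep; swap; trans)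
import Data.List.Relation.Binary.Permutation.Setoid as PermutationSetoid
import Data.List.Relation.Binary.Permutation.Setoid.Properties as PermutationProperties
open import Data.List.Relation.Binary.Pointwise using (Pointwise; []; _∷_)
open import Data.List.Relation.Unary.All using (All; []; _∷_)
open import Data.List.Relation.Unary.Any as Any using (Any; here; there)
import Data.Nat
open import Data.Nat using (suc; _≡ᵇ_)
open import Data.List.Membership.DecPropositional Data.Nat._≟_ using (_∈?_)
open import Data.Nat.Properties using (≡ᵇ⇒≡)
open import Data.Product using (Σ; _×_; _,_; proj₁; proj₂)
open import Data.Sum using (_⊎_; inj₁; inj₂)
open import Data.Vec using (Vec; []; _∷_; _[_]≔_)
open import Function using (_∘_)
open import Level using (0ℓ)
open import Relation.Binary.Bundles using (Setoid)
open import Relation.Binary.Core using (Rel)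
open import Relation.Binary.PropositionalEquality as ≡
  using (_≡_; _≢_; cong; cong₂; subst; module ≡-Reasoning)
open import Relation.Binary.PropositionalEquality.Properties using (setoid)
open import Relation.Nullary.Decidable using (¬?)

module TermProperties (Σᶠ : Sig) where
  open Sig Σᶠ
  open Terms Σᶠ

  Ground : Subst → Set
  Ground ρ = ∀ x → IsGround (ρ x)

  _⨾_ : Subst → Subst → Subst
  (σ ⨾ τ) x = σ x ⟨ τ ⟩

  mutual
    ⟨⟩-⨾ : ∀ t σ τ → (t ⟨ σ ⟩) ⟨ τ ⟩ ≡ t ⟨ σ ⨾ τ ⟩
    ⟨⟩-⨾ (var x)    σ τ = ≡.refl
    ⟨⟩-⨾ (app f ts) σ τ = cong (app f) (⟨⟩*-⨾ ts σ τ)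

    ⟨⟩*-⨾ : ∀ {n} (ts : Vec Term n) σ τ → (ts ⟨ σ ⟩*) ⟨ τ ⟩* ≡ ts ⟨ σ ⨾ τ ⟩*
    ⟨⟩*-⨾ []       σ τ = ≡.refl
    ⟨⟩*-⨾ (t ∷ ts) σ τ = cong₂ _∷_ (⟨⟩-⨾ t σ τ) (⟨⟩*-⨾ ts σ τ)

  mutual
    ⟨⟩-local : ∀ t {σ τ} → (∀ x → x ∈ vars t → σ x ≡ τ x) → t ⟨ σ ⟩ ≡ t ⟨ τ ⟩
    ⟨⟩-local (var x)    σ≗τ = σ≗τ x (here ≡.refl)
    ⟨⟩-local (app f ts) σ≗τ = cong (app f) (⟨⟩*-local ts σ≗τ)

    ⟨⟩*-local : ∀ {n} (ts : Vec Term n) {σ τ} →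
                (∀ x → x ∈ vars* ts → σ x ≡ τ x) → ts ⟨ σ ⟩* ≡ ts ⟨ τ ⟩*
    ⟨⟩*-local []       σ≗τ = ≡.refl
    ⟨⟩*-local (t ∷ ts) σ≗τ =
      cong₂ _∷_ (⟨⟩-local t (λ x x∈t → σ≗τ x (∈-++⁺ˡ x∈t)))
                (⟨⟩*-local ts (λ x x∈ts → σ≗τ x (∈-++⁺ʳ (vars t) x∈ts)))

  mutual
    ⟨var⟩ : ∀ t → t ⟨ var ⟩ ≡ t
    ⟨var⟩ (var x)    = ≡.refl
    ⟨var⟩ (app f ts) = cong (app f) (⟨var⟩* ts)

    ⟨var⟩* : ∀ {n} (ts : Vec Term n) → ts ⟨ var ⟩* ≡ ts
    ⟨var⟩* []       = ≡.refl
    ⟨var⟩* (t ∷ ts) = cong₂ _∷_ (⟨var⟩ t) (⟨var⟩* ts)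

  ground-⟨⟩ : ∀ {g} τ → IsGround g → g ⟨ τ ⟩ ≡ g
  ground-⟨⟩ {g} τ g-ground = ≡.trans (⟨⟩-local g (λ x x∈g → ⊥-elim (g-ground x x∈g))) (⟨var⟩ g)

  mutual
    vars-⟨⟩ : ∀ t ρ {x} → x ∈ vars (t ⟨ ρ ⟩) → Σ Var λ y → x ∈ vars (ρ y)
    vars-⟨⟩ (var y)    ρ x∈ρy = y , x∈ρy
    vars-⟨⟩ (app f ts) ρ x∈ts = vars-⟨⟩* ts ρ x∈ts

    vars-⟨⟩* : ∀ {n} (ts : Vec Term n) ρ {x} → x ∈ vars* (ts ⟨ ρ ⟩*) → Σ Var λ y → x ∈ vars (ρ y)
    vars-⟨⟩* (t ∷ ts) ρ x∈ with ∈-++⁻ (vars (t ⟨ ρ ⟩)) x∈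
    ... | inj₁ x∈t  = vars-⟨⟩ t ρ x∈t
    ... | inj₂ x∈ts = vars-⟨⟩* ts ρ x∈ts

  ⨾-ground : ∀ σ {ρ} → Ground ρ → Ground (σ ⨾ ρ)
  ⨾-ground σ {ρ} ρ-ground y x x∈ with vars-⟨⟩ (σ y) ρ x∈
  ... | z , x∈ρz = ρ-ground z x x∈ρz

  constTerm : Term
  constTerm = app const (subst (Vec Term) (≡.sym const-ar) [])

  constTerm-ground : IsGround constTerm
  constTerm-ground = no-arguments const-ar
    where
    no-arguments : ∀ {n} (n≡0 : n ≡ 0) x → x ∉ vars* (subst (Vec Term) (≡.sym n≡0) [])
    no-arguments ≡.refl x ()

  constSubst : Subst
  constSubst _ = constTerm

  constSubst-ground : Ground constSubst
  constSubst-ground _ = constTerm-ground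

  -- An mgu only yields θ = σ ⨾ δ for some δ; composing with constSubst makes δ ground.
  mgu-ground-instance : ∀ {σ s t θ} → IsMGU σ s t → s ⟨ θ ⟩ ≡ t ⟨ θ ⟩ → Ground θ →
                        Σ Subst λ δ → Ground δ × (∀ x → (σ ⨾ δ) x ≡ θ x)
  mgu-ground-instance {σ} {θ = θ} (_ , most-general) unifies θ-ground =
    δ ⨾ constSubst , ⨾-ground δ constSubst-ground , factors
    where
    open ≡-Reasoning
    δ = proj₁ (most-general θ unifies)
    factors : ∀ x → (σ ⨾ (δ ⨾ constSubst)) x ≡ θ x
    factors x = begin
      σ x ⟨ δ ⨾ constSubst ⟩     ≡⟨ ⟨⟩-⨾ (σ x) δ constSubst ⟨
      (σ x ⟨ δ ⟩) ⟨ constSubst ⟩ ≡⟨ cong (_⟨ constSubst ⟩) (proj₂ (most-general θ unifies) x) ⟨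
      θ x ⟨ constSubst ⟩         ≡⟨ ground-⟨⟩ constSubst (θ-ground x) ⟩
      θ x                        ∎

  _⟨_⟩ᶜ : Ctx → Subst → Ctx
  ∙              ⟨ θ ⟩ᶜ = ∙
  app f i ts c   ⟨ θ ⟩ᶜ = app f i (ts ⟨ θ ⟩*) (c ⟨ θ ⟩ᶜ)

  []≔-⟨⟩* : ∀ {n} (ts : Vec Term n) i u θ → (ts [ i ]≔ u) ⟨ θ ⟩* ≡ (ts ⟨ θ ⟩*) [ i ]≔ (u ⟨ θ ⟩)
  []≔-⟨⟩* (t ∷ ts) fzero    u θ = ≡.refl
  []≔-⟨⟩* (t ∷ ts) (fsuc i) u θ = cong ((t ⟨ θ ⟩) ∷_) ([]≔-⟨⟩* ts i u θ)

  plug-⟨⟩ : ∀ c u θ → (plug c u) ⟨ θ ⟩ ≡ plug (c ⟨ θ ⟩ᶜ) (u ⟨ θ ⟩)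
  plug-⟨⟩ ∙              u θ = ≡.refl
  plug-⟨⟩ (app f i ts c) u θ =
    cong (app f) (≡.trans ([]≔-⟨⟩* ts i (plug c u) θ) (cong ((ts ⟨ θ ⟩*) [ i ]≔_) (plug-⟨⟩ c u θ)))

  module _ (M : Structure) (a : Var → Structure.Carrier M) where

    eval*-[]≔ : ∀ {n} (ts : Vec Term n) i u → eval* M a (ts [ i ]≔ u) ≡ (eval* M a ts) [ i ]≔ eval M a u
    eval*-[]≔ (t ∷ ts) fzero    u = ≡.refl
    eval*-[]≔ (t ∷ ts) (fsuc i) u = cong (eval M a t ∷_) (eval*-[]≔ ts i u)

    eval-plug-cong : ∀ c {u v} → eval M a u ≡ eval M a v → eval M a (plug c u) ≡ eval M a (plug c v)
    eval-plug-cong ∙              u=v = u=v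
    eval-plug-cong (app f i ts c) {u} {v} u=v = cong (Structure.interp M f) (begin
      eval* M a (ts [ i ]≔ plug c u)         ≡⟨ eval*-[]≔ ts i (plug c u) ⟩
      eval* M a ts [ i ]≔ eval M a (plug c u) ≡⟨ cong (eval* M a ts [ i ]≔_) (eval-plug-cong c u=v) ⟩
      eval* M a ts [ i ]≔ eval M a (plug c v) ≡⟨ eval*-[]≔ ts i (plug c v) ⟨
      eval* M a (ts [ i ]≔ plug c v)         ∎)
      where open ≡-Reasoning

    LitTrue-resp-≈L : ∀ {L L′} → L ≈L L′ → LitTrue M a L → LitTrue M a L′
    LitTrue-resp-≈L {mkLit true  s t} (≡.refl , inj₁ (≡.refl , ≡.refl)) s=t = s=t
    LitTrue-resp-≈L {mkLit true  s t} (≡.refl , inj₂ (≡.refl , ≡.refl)) s=t = ≡.sym s=t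
    LitTrue-resp-≈L {mkLit false s t} (≡.refl , inj₁ (≡.refl , ≡.refl)) s≠t = s≠t
    LitTrue-resp-≈L {mkLit false s t} (≡.refl , inj₂ (≡.refl , ≡.refl)) s≠t = s≠t ∘ ≡.sym

    LitTrue-lhs-cong : ∀ p {s s′ t} → eval M a s ≡ eval M a s′ →
                       LitTrue M a (mkLit p s′ t) → LitTrue M a (mkLit p s t)
    LitTrue-lhs-cong true  s=s′ s′=t = ≡.trans s=s′ s′=t
    LitTrue-lhs-cong false s=s′ s′≠t s=t = s′≠t (≡.trans (≡.sym s=s′) s=t)

  ≈L-refl : ∀ {L} → L ≈L L
  ≈L-refl = ≡.refl , inj₁ (≡.refl , ≡.refl)

  ≈L-sym : ∀ {L M} → L ≈L M → M ≈L L
  ≈L-sym (p , inj₁ (s , t)) = ≡.sym p , inj₁ (≡.sym s , ≡.sym t)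
  ≈L-sym (p , inj₂ (s , t)) = ≡.sym p , inj₂ (≡.sym t , ≡.sym s)

  ≈L-trans : ∀ {L M N} → L ≈L M → M ≈L N → L ≈L N
  ≈L-trans (p , inj₁ (s , t)) (q , inj₁ (s′ , t′)) = ≡.trans p q , inj₁ (≡.trans s s′ , ≡.trans t t′)
  ≈L-trans (p , inj₁ (s , t)) (q , inj₂ (s′ , t′)) = ≡.trans p q , inj₂ (≡.trans s s′ , ≡.trans t t′)
  ≈L-trans (p , inj₂ (s , t)) (q , inj₁ (s′ , t′)) = ≡.trans p q , inj₂ (≡.trans s t′ , ≡.trans t s′)
  ≈L-trans (p , inj₂ (s , t)) (q , inj₂ (s′ , t′)) = ≡.trans p q , inj₁ (≡.trans s t′ , ≡.trans t s′)

  litSetoid : Setoid 0ℓ 0ℓ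
  litSetoid = record
    { Carrier       = Lit
    ; _≈_           = _≈L_
    ; isEquivalence = record { refl = ≈L-refl ; sym = ≈L-sym ; trans = ≈L-trans }
    }

  ⟨⟩C-⨾ : ∀ C σ τ → (C ⟨ σ ⟩C) ⟨ τ ⟩C ≡ C ⟨ σ ⨾ τ ⟩C
  ⟨⟩C-⨾ []                σ τ = ≡.refl
  ⟨⟩C-⨾ (mkLit p s t ∷ C) σ τ =
    cong₂ _∷_ (cong₂ (mkLit p) (⟨⟩-⨾ s σ τ) (⟨⟩-⨾ t σ τ)) (⟨⟩C-⨾ C σ τ)

  ⟨⟩C-local : ∀ C {σ τ} → (∀ x → x ∈ varsC C → σ x ≡ τ x) → C ⟨ σ ⟩C ≡ C ⟨ τ ⟩C
  ⟨⟩C-local []                σ≗τ = ≡.refl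
  ⟨⟩C-local (mkLit p s t ∷ C) σ≗τ =
    cong₂ _∷_ (cong₂ (mkLit p) (⟨⟩-local s (λ x x∈s → σ≗τ x (∈-++⁺ˡ (∈-++⁺ˡ x∈s))))
                               (⟨⟩-local t (λ x x∈t → σ≗τ x (∈-++⁺ˡ (∈-++⁺ʳ (vars s) x∈t)))))
              (⟨⟩C-local C (λ x x∈C → σ≗τ x (∈-++⁺ʳ (vars s ++ vars t) x∈C)))

  ≈L-⟨⟩L : ∀ {L M} θ → L ≈L M → (L ⟨ θ ⟩L) ≈L (M ⟨ θ ⟩L)
  ≈L-⟨⟩L θ (≡.refl , inj₁ (≡.refl , ≡.refl)) = ≈L-refl
  ≈L-⟨⟩L θ (≡.refl , inj₂ (≡.refl , ≡.refl)) = ≡.refl , inj₂ (≡.refl , ≡.refl)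

  ≅-⟨⟩C : ∀ {C D} θ → C ≅ D → (C ⟨ θ ⟩C) ≅ (D ⟨ θ ⟩C)
  ≅-⟨⟩C θ (refl C≋D)       = refl (pointwise C≋D)
    where
    pointwise : ∀ {C D} → Pointwise _≈L_ C D → Pointwise _≈L_ (C ⟨ θ ⟩C) (D ⟨ θ ⟩C)
    pointwise []           = []
    pointwise (L≈M ∷ C≋D) = ≈L-⟨⟩L θ L≈M ∷ pointwise C≋D
  ≅-⟨⟩C θ (prep L≈M C≅D)   = prep (≈L-⟨⟩L θ L≈M) (≅-⟨⟩C θ C≅D)
  ≅-⟨⟩C θ (swap L≈ M≈ C≅D) = swap (≈L-⟨⟩L θ L≈) (≈L-⟨⟩L θ M≈) (≅-⟨⟩C θ C≅D)
  ≅-⟨⟩C θ (trans C≅D D≅E)  = trans (≅-⟨⟩C θ C≅D) (≅-⟨⟩C θ D≅E)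

  module _ (S : Setoid 0ℓ 0ℓ) {_>_ : Rel (Setoid.Carrier S) 0ℓ} where
    open Setoid S using (_≈_)
    open PermutationSetoid S using (_↭_; ↭-refl)
    open PermutationProperties S using (++-comm)

    mulExt-dominated : ∀ {xs ys ys′} → ys ↭ ys′ → xs ≢ [] →
                       All (λ y → Any (_> y) xs) ys′ → MulExt _≈_ _>_ xs ys
    mulExt-dominated {xs} ys↭ys′ xs≢[] dominated =
      xs , _ , [] , ↭-refl , ys↭ys′ , xs≢[] , dominated

    mulExt-++ʳ : ∀ xs ys {zs} → xs ≢ [] → All (λ y → Any (_> y) xs) ys →
                 MulExt _≈_ _>_ (xs ++ zs) (ys ++ zs)
    mulExt-++ʳ xs ys {zs} xs≢[] dominated =
      xs , ys , zs , ++-comm xs zs , ++-comm ys zs , xs≢[] , dominated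

module PRCProperties (Σᶠ : Sig) (Π : PredSig Σᶠ) (O : SimpOrd Σᶠ) (SF : Selection Σᶠ) where
  open Terms Σᶠ
  open PRC Σᶠ Π O SF
  open SimpOrd O using (_≻_; monotone)
  open TermProperties Σᶠ

  _C≻_ : Clause → Term → Set
  C C≻ u = Any (λ L → lhs L ≻ u ⊎ rhs L ≻ u) C

  ≻L-pos : ∀ {L u v} → u ≻ v → lhs L ≻ u ⊎ rhs L ≻ u → L ≻L pos u v
  ≻L-pos {L} u≻v side≻u =
    mulExt-dominated (setoid Term) ↭-refl (any⇒≢[] (side∈ L side≻u))
      (side∈ L side≻u ∷ Any.map (λ w≻u → SimpOrd.trans O w≻u u≻v) (side∈ L side≻u) ∷ [])
    where
    open PermutationSetoid (setoid Term) using (↭-refl)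
    side∈ : ∀ L {u} → lhs L ≻ u ⊎ rhs L ≻ u → Any (_≻ u) (litMS L)
    side∈ (mkLit true  s t) (inj₁ s≻u) = here s≻u
    side∈ (mkLit true  s t) (inj₂ t≻u) = there (here t≻u)
    side∈ (mkLit false s t) (inj₁ s≻u) = here s≻u
    side∈ (mkLit false s t) (inj₂ t≻u) = there (there (here t≻u))
    any⇒≢[] : ∀ {P : Term → Set} {xs} → Any P xs → xs ≢ []
    any⇒≢[] (here _)  ()
    any⇒≢[] (there _) ()

  ≻L-lhs : ∀ p {s s′ t} → s ≻ s′ → mkLit p s t ≻L mkLit p s′ t
  ≻L-lhs true  {s} {s′} s≻s′ = mulExt-++ʳ (setoid Term) (s ∷ []) (s′ ∷ []) (λ ()) (here s≻s′ ∷ [])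
  ≻L-lhs false {s} {s′} s≻s′ =
    mulExt-++ʳ (setoid Term) (s ∷ s ∷ []) (s′ ∷ s′ ∷ []) (λ ()) (here s≻s′ ∷ here s≻s′ ∷ [])

  rewrite-redundant : ∀ {T : Clause → Set} c p u v t Q {E} → E ≅ (pos u v ∷ []) → u ≻ v →
                      (mkLit p (plug c u) t ∷ Q) C≻ u → T E → T (mkLit p (plug c v) t ∷ Q) →
                      Redundant (mkLit p (plug c u) t ∷ Q) T
  rewrite-redundant c p u v t Q {E} E≅u≈v u≻v D≻u E∈T D′∈T =
    E ∷ D′ ∷ [] , E∈T ∷ D′∈T ∷ [] , entails , D≻E ∷ D≻D′ ∷ []
    where
    open PermutationProperties litSetoid using (Any-resp-↭)
    D D′ : Clause
    D  = mkLit p (plug c u) t ∷ Q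
    D′ = mkLit p (plug c v) t ∷ Q
    entails : (E ∷ D′ ∷ []) ⊨ D
    entails M a (E-true ∷ D′-true ∷ []) with Any-resp-↭ (LitTrue-resp-≈L M a) E≅u≈v E-true | D′-true
    ... | here u=v | here D′-head = here (LitTrue-lhs-cong M a p (eval-plug-cong M a c u=v) D′-head)
    ... | here u=v | there Q-true = there Q-true
    D≻E : D ≻C E
    D≻E = mulExt-dominated litSetoid E≅u≈v (λ ()) (Any.map (≻L-pos u≻v) D≻u ∷ [])
    D≻D′ : D ≻C D′
    D≻D′ = mulExt-++ʳ litSetoid (_ ∷ []) (_ ∷ []) (λ ()) (here (≻L-lhs p (monotone c u≻v)) ∷ [])

  [↦]-ground : ∀ {ρ} y {g} → Ground ρ → IsGround g → Ground (ρ [ y ↦ g ])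
  [↦]-ground y ρ-ground g-ground x with x ≡ᵇ y
  ... | true  = g-ground
  ... | false = ρ-ground x

  [↦]-other : ∀ ρ y g {x} → x ≢ y → (ρ [ y ↦ g ]) x ≡ ρ x
  [↦]-other ρ y g {x} x≢y with x ≡ᵇ y in x≡ᵇy
  ... | true  = ⊥-elim (x≢y (≡ᵇ⇒≡ x y (subst Bool.T (≡.sym x≡ᵇy) _)))
  ... | false = ≡.refl

  ⟦∃*f⟧-witness : ∀ ys φ {ρ} → Ground ρ → ⟦ ∃*f ys φ ⟧ ρ →
    Σ Subst λ ρ′ → ⟦ φ ⟧ ρ′ × Ground ρ′ × (∀ x → x ∉ ys → ρ′ x ≡ ρ x)
  ⟦∃*f⟧-witness []       φ ρ-ground ⟦φ⟧ = _ , ⟦φ⟧ , ρ-ground , λ _ _ → ≡.refl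
  ⟦∃*f⟧-witness (y ∷ ys) φ {ρ} ρ-ground (g , g-ground , ⟦∃ys⟧)
    with ⟦∃*f⟧-witness ys φ ([↦]-ground y ρ-ground g-ground) ⟦∃ys⟧
  ... | ρ′ , ⟦φ⟧ , ρ′-ground , ρ′-outside =
    ρ′ , ⟦φ⟧ , ρ′-ground ,
    λ x x∉ → ≡.trans (ρ′-outside x (x∉ ∘ there)) ([↦]-other ρ y g (x∉ ∘ here))

  ⟦C≻f⟧ : ∀ C l ρ → ⟦ C C≻f l ⟧ ρ → (C ⟨ ρ ⟩C) C≻ (l ⟨ ρ ⟩)
  ⟦C≻f⟧ (L ∷ C) l ρ (inj₁ L≻l) = here L≻l
  ⟦C≻f⟧ (L ∷ C) l ρ (inj₂ C≻l) = there (⟦C≻f⟧ C l ρ C≻l)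

  record GroundExtension (θ : Subst) (l r l′ : Term) (C : Clause) : Set where
    field
      θ′        : Subst
      ground    : Ground θ′
      agrees    : C ⟨ θ ⟩C ≡ C ⟨ θ′ ⟩C
      unifies   : l ⟨ θ′ ⟩ ≡ l′ ⟨ θ′ ⟩
      oriented  : (l ⟨ θ′ ⟩) ≻ (r ⟨ θ′ ⟩)
      dominated : (C ⟨ θ′ ⟩C) C≻ (l ⟨ θ′ ⟩)

  lemmaR-ground-extension : ∀ θ l r l′ C → Grounding θ C → θ ⊨F lemmaR l r l′ C →
                            GroundExtension θ l r l′ C
  lemmaR-ground-extension θ l r l′ C θ-grounds θ⊨R =
    extend (⟦∃*f⟧-witness ȳ body (⨾-ground θ constSubst-ground) (θ⊨R constSubst constSubst-ground))
    where
    ȳ : List Var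
    ȳ = filter (λ y → ¬? (y ∈? varsC C)) (vars l ++ vars r)
    body : Formula
    body = (l =f l′) ∧f ((l ≻f r) ∧f (C C≻f l))
    extend : (Σ Subst λ θ′ → ⟦ body ⟧ θ′ × Ground θ′ × (∀ x → x ∉ ȳ → θ′ x ≡ (θ ⨾ constSubst) x)) →
             GroundExtension θ l r l′ C
    extend (θ′ , (unifies , oriented , dominated) , θ′-ground , θ′-outside) = record
      { θ′ = θ′ ; ground = θ′-ground ; agrees = ⟨⟩C-local C agrees-on-C
      ; unifies = unifies ; oriented = oriented ; dominated = ⟦C≻f⟧ C l θ′ dominated }
      where
      agrees-on-C : ∀ x → x ∈ varsC C → θ x ≡ θ′ x
      agrees-on-C x x∈C = ≡.sym (≡.trans (θ′-outside x x∉ȳ) (ground-⟨⟩ constSubst (θ-grounds x x∈C)))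
        where
        x∉ȳ : x ∉ ȳ
        x∉ȳ x∈ȳ = proj₂ (∈-filter⁻ (λ y → ¬? (y ∈? varsC C)) {xs = vars l ++ vars r} x∈ȳ) x∈C

  sup-instance-redundant : ∀ {S T : PSet} (inf : Sup S) → Sup.C₁ inf ≡ [] →
    (∀ {x} → S x → T x) → T (Sup.conclusion inf , ⊥f) → ∀ {θ} → Ground θ →
    let open Sup inf in
    l ⟨ θ ⟩ ≡ l' ⟨ θ ⟩ → (l ⟨ θ ⟩) ≻ (r ⟨ θ ⟩) → (premise₂ ⟨ θ ⟩C) C≻ (l ⟨ θ ⟩) →
    Redundant (premise₂ ⟨ θ ⟩C) (Star T)
  sup-instance-redundant {T = T} inf C₁≡[] S⊆T conclusion∈T {θ} θ-ground unifies oriented dominated =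
    subst (λ D → Redundant D (Star T)) (≡.sym premise₂-instance)
      (rewrite-redundant (c ⟨ θ ⟩ᶜ) pl (l ⟨ θ ⟩) (r ⟨ θ ⟩) (t ⟨ θ ⟩) (C₂ ⟨ θ ⟩C)
        premise₁-instance oriented (subst (_C≻ (l ⟨ θ ⟩)) premise₂-instance dominated)
        premise₁∈T* conclusion∈T*)
    where
    open Sup inf
    open ≡-Reasoning
    premise₂-instance : premise₂ ⟨ θ ⟩C ≡ mkLit pl (plug (c ⟨ θ ⟩ᶜ) (l ⟨ θ ⟩)) (t ⟨ θ ⟩) ∷ (C₂ ⟨ θ ⟩C)
    premise₂-instance = cong (λ s → mkLit pl s (t ⟨ θ ⟩) ∷ (C₂ ⟨ θ ⟩C))
      (≡.trans (plug-⟨⟩ c l' θ) (cong (plug (c ⟨ θ ⟩ᶜ)) (≡.sym unifies)))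
    premise₁-instance : (Premise.clause p₁ ⟨ θ ⟩C) ≅ (pos (l ⟨ θ ⟩) (r ⟨ θ ⟩) ∷ [])
    premise₁-instance =
      subst (λ C → (Premise.clause p₁ ⟨ θ ⟩C) ≅ ((pos l r ∷ C) ⟨ θ ⟩C)) C₁≡[] (≅-⟨⟩C θ shape₁)
    premise₁∈T* : Star T (Premise.clause p₁ ⟨ θ ⟩C)
    premise₁∈T* = cl₀ , fm₀ , S⊆T member , (var ∘ ren) ⨾ θ , (λ x _ → θ-ground (ren x)) ,
                  ⟨⟩C-⨾ cl₀ (var ∘ ren) θ
      where open Premise p₁
    conclusion∈T* : Star T (mkLit pl (plug (c ⟨ θ ⟩ᶜ) (r ⟨ θ ⟩)) (t ⟨ θ ⟩) ∷ (C₂ ⟨ θ ⟩C))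
    conclusion∈T* with mgu-ground-instance {σ} {l} {l'} mgu unifies θ-ground
    ... | δ , δ-ground , σ⨾δ≗θ = conclusion , ⊥f , conclusion∈T , δ , (λ x _ → δ-ground x) , (begin
      mkLit pl (plug (c ⟨ θ ⟩ᶜ) (r ⟨ θ ⟩)) (t ⟨ θ ⟩) ∷ (C₂ ⟨ θ ⟩C)
        ≡⟨ cong (λ s → mkLit pl s (t ⟨ θ ⟩) ∷ (C₂ ⟨ θ ⟩C)) (plug-⟨⟩ c r θ) ⟨
      (mkLit pl (plug c r) t ∷ ([] ++ C₂)) ⟨ θ ⟩C
        ≡⟨ cong (λ C → (mkLit pl (plug c r) t ∷ (C ++ C₂)) ⟨ θ ⟩C) C₁≡[] ⟨
      (mkLit pl (plug c r) t ∷ (C₁ ++ C₂)) ⟨ θ ⟩C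
        ≡⟨ ⟨⟩C-local (mkLit pl (plug c r) t ∷ (C₁ ++ C₂)) (λ x _ → σ⨾δ≗θ x) ⟨
      (mkLit pl (plug c r) t ∷ (C₁ ++ C₂)) ⟨ σ ⨾ δ ⟩C
        ≡⟨ ⟨⟩C-⨾ (mkLit pl (plug c r) t ∷ (C₁ ++ C₂)) σ δ ⟨
      conclusion ⟨ δ ⟩C
        ∎)

lemma7 : (Σᶠ : Sig) (Π : PredSig Σᶠ) (O : SimpOrd Σᶠ) (SF : Selection Σᶠ) →
    let open Terms Σᶠ
        open PRC Σᶠ Π O SF
    in (S : Data.Nat.ℕ → PSet) (j : Data.Nat.ℕ) →
       Saturation S (Data.Nat.suc j) →
       (inf : Sup (S j)) →
       Sup.C₁ inf ≡ [] →
       (S (Data.Nat.suc j) ≐S (λ x → S j x ⊎ x ≡ (Sup.conclusion inf , ⊥f))) →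
       Admissible (S (Data.Nat.suc j)) (Sup.premise₂ inf)
                  (lemmaR (Sup.l inf) (Sup.r inf) (Sup.l' inf) (Sup.premise₂ inf))
-- Only the last step matters: the first premise lies in S j and the conclusion in S (suc j).
lemma7 Σᶠ Π O SF S j _ inf C₁≡[] S⁺≐ θ θ-grounds θ⊨R =
  subst (λ D → Redundant D (Star (S (suc j)))) (≡.sym agrees)
    (sup-instance-redundant inf C₁≡[] (λ x∈S → proj₂ (S⁺≐ _) (inj₁ x∈S)) (proj₂ (S⁺≐ _) (inj₂ ≡.refl))
      ground unifies oriented dominated)
  where
  open PRC Σᶠ Π O SF
  open PRCProperties Σᶠ Π O SF
  open Sup inf using (l; r; l'; premise₂)
  open GroundExtension (lemmaR-ground-extension θ l r l' premise₂ θ-grounds θ⊨R)
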